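{- Let $(R,\mathfrak{m})$ be a finite local Frobenius ring with residue field $\mathbb{F}_2$. Let $r_1,r_2\in\mathfrak{m}$. Then for all $x\in R$, \[c(r_1,R/\mathrm{Ann}_R(x))\equiv c(r_2,R/\mathrm{Ann}_R(x))\pmod 4.\]
   Context: All rings are finite, commutative with identity. A finite ring $R$ is Frobenius if for some positive integer $n$ with $nR=0$ there is a $\mathbb{Z}/n$-linear map $\psi\colon R\to\mathbb{Z}/n$ whose kernel contains no nonzero ideal. For a finite ring $T$, $\varphi(T)=|T^\times|$ (with $\varphi$ of the zero ring equal to $1$), and $\mu(T)=(-1)^k$ if $T$ is isomorphic to a product of $k\ge 0$ fields (the zero ring being the empty product), and $\mu(T)=0$ otherwise. The Ramanujan sum is given, for $r,x\in R$, by \[c(r,R/\mathrm{Ann}_R(x))=\frac{\varphi(R/\mathrm{Ann}_R(x))}{\varphi(R/\mathrm{Ann}_R(rx))}\,\mu(R/\mathrm{Ann}_R(rx)).\] -}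

module Defs where

open import Level using (Level; _⊔_) renaming (suc to lsuc)
open import Data.Nat using (ℕ; zero; suc; pred)
open import Data.Integer as ℤ using (ℤ; +_)
open import Data.Integer.Divisibility using (_∣_)
open import Data.Bool using (Bool; true; false; _xor_; _∧_)
open import Data.Fin using (Fin)
open import Data.List using (List; length; filter; deduplicate)
open import Data.List.Relation.Unary.Any using (Any; any?)
open import Data.Product using (Σ; Σ-syntax; ∃; ∃-syntax; _×_; _,_)
open import Data.Sum using (_⊎_)
open import Relation.Nullary using (¬_; Dec)
open import Relation.Binary.PropositionalEquality using (_≡_)
open import Relation.Binary.Core using (Rel)
open import Function.Bundles using (_⇔_)
open import Algebra.Bundles using (CommutativeRing)
open import Algebra.Bundles.Raw using (RawRing)
open import Data.Rational.Unnormalised as ℚᵘ using (ℚᵘ; mkℚᵘ; _≃_)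

record FinRawRing c ℓ : Set (lsuc (c ⊔ ℓ)) where
  field
    raw   : RawRing c ℓ
  open RawRing raw public
  field
    _≟_   : (a b : Carrier) → Dec (a ≈ b)
    elems : List Carrier
    complete : ∀ a → Any (a ≈_) elems

record Finite {c ℓ} (R : CommutativeRing c ℓ) : Set (c ⊔ ℓ) where
  open CommutativeRing R
  field
    _≟_   : (a b : Carrier) → Dec (a ≈ b)
    elems : List Carrier
    complete : ∀ a → Any (a ≈_) elems

module _ {c ℓ} (R : CommutativeRing c ℓ) where
  open CommutativeRing R

  IsUnit : Carrier → Set (c ⊔ ℓ)
  IsUnit a = ∃[ b ] (a * b ≈ 1#)

  _·_ : ℕ → Carrier → Carrier
  zero  · a = 0#
  suc n · a = a + (n · a)

  record IsIdeal (I : Carrier → Set (c ⊔ ℓ)) : Set (c ⊔ ℓ) where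
    field
      resp  : ∀ {a b} → a ≈ b → I a → I b
      zero∈ : I 0#
      +-closed : ∀ {a b} → I a → I b → I (a + b)
      *-closed : ∀ r {a} → I a → I (r * a)

  -- Frobenius: some n > 0 with nR = 0 and a Z/n-linear ψ : R → Z/n
  -- (values in ℤ, read modulo n) whose kernel contains no nonzero ideal.
  Frobenius : Set (lsuc (c ⊔ ℓ))
  Frobenius =
    Σ[ n ∈ ℕ ] Σ[ ψ ∈ (Carrier → ℤ) ]
      ( (0 Data.Nat.< n)
      × (∀ a → n · a ≈ 0#)
      × (∀ {a b} → a ≈ b → + n ∣ (ψ a ℤ.- ψ b))
      × (∀ a b → + n ∣ (ψ (a + b) ℤ.- (ψ a ℤ.+ ψ b)))
      × (∀ k a → + n ∣ (ψ (k · a) ℤ.- (+ k ℤ.* ψ a)))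
      × (∀ (I : Carrier → Set (c ⊔ ℓ)) → IsIdeal I →
           (∀ a → I a → + n ∣ ψ a) → ∀ a → I a → a ≈ 0#) )

  -- (R, 𝔪) local with residue field 𝔽₂: there is a surjective ring
  -- homomorphism π : R → 𝔽₂ (𝔽₂ = Bool with xor, ∧) whose kernel is the
  -- set of non-units 𝔪.  (Then 𝔪 is the unique maximal ideal and R/𝔪 ≅ 𝔽₂.)
  LocalWithResidueF₂ : Set (c ⊔ ℓ)
  LocalWithResidueF₂ =
    Σ[ π ∈ (Carrier → Bool) ]
      ( (∀ {a b} → a ≈ b → π a ≡ π b)
      × (∀ a b → π (a + b) ≡ (π a xor π b))
      × (∀ a b → π (a * b) ≡ (π a ∧ π b))
      × (π 1# ≡ true)
      × (∀ a → (π a ≡ false) ⇔ (¬ IsUnit a)) )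

  _∈𝔪 : Carrier → Set (c ⊔ ℓ)
  a ∈𝔪 = ¬ IsUnit a

  R/Ann : Finite R → Carrier → FinRawRing c ℓ
  R/Ann fin x = record
    { raw = record
        { Carrier = Carrier
        ; _≈_ = λ a b → (a - b) * x ≈ 0#
        ; _+_ = _+_ ; _*_ = _*_ ; -_ = -_ ; 0# = 0# ; 1# = 1# }
    ; _≟_ = λ a b → Finite._≟_ fin ((a - b) * x) 0#
    ; elems = Finite.elems fin
    ; complete = λ a → Data.List.Relation.Unary.Any.map
        (λ {b} a≈b → trans (*-congʳ (trans (+-congʳ a≈b) (-‿inverseʳ b))) (zeroˡ x))
        (Finite.complete fin a)
    }

-- φ(T) = |T^×| for a finite ring T: number of ≈-classes of units.

module _ {c ℓ} (T : FinRawRing c ℓ) where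
  open FinRawRing T

  isUnit? : (a : Carrier) → Dec (Any (λ b → (a * b) ≈ 1#) elems)
  isUnit? a = any? (λ b → (a * b) ≟ 1#) elems

  φ : ℕ
  φ = length (deduplicate _≟_ (filter isUnit? elems))

module _ {c ℓ} (F : CommutativeRing c ℓ) where
  open CommutativeRing F
  IsField : Set (c ⊔ ℓ)
  IsField = (¬ 1# ≈ 0#) × (∀ a → ¬ a ≈ 0# → ∃[ b ] (a * b ≈ 1#))

RingIsoToProduct : ∀ {c ℓ} (T : RawRing c ℓ) (k : ℕ)
  (F : Fin k → CommutativeRing c ℓ) → Set (c ⊔ ℓ)
RingIsoToProduct T k F =
  Σ[ f ∈ ((a : T.Carrier) → (i : Fin k) → CR.Carrier (F i)) ]
    ( (∀ a b → (a T.≈ b) ⇔ (∀ i → CR._≈_ (F i) (f a i) (f b i)))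
    × (∀ (y : (i : Fin k) → CR.Carrier (F i)) →
         ∃[ a ] (∀ i → CR._≈_ (F i) (f a i) (y i)))
    × (∀ a b i → CR._≈_ (F i) (f (a T.+ b) i) (CR._+_ (F i) (f a i) (f b i)))
    × (∀ a b i → CR._≈_ (F i) (f (a T.* b) i) (CR._*_ (F i) (f a i) (f b i)))
    × (∀ i → CR._≈_ (F i) (f T.1# i) (CR.1# (F i))) )
  where
    module T = RawRing T
    module CR = CommutativeRing

IsProductOfFields : ∀ {c ℓ} (T : RawRing c ℓ) (k : ℕ) → Set (lsuc (c ⊔ ℓ))
IsProductOfFields {c} {ℓ} T k =
  Σ[ F ∈ (Fin k → CommutativeRing c ℓ) ] ((∀ i → IsField (F i)) × RingIsoToProduct T k F)

sign : ℕ → ℤ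
sign zero = + 1
sign (suc k) = ℤ.- sign k

-- μ(T) = v  (graph of the function μ)
μ-is : ∀ {c ℓ} (T : RawRing c ℓ) → ℤ → Set (lsuc (c ⊔ ℓ))
μ-is T v =
  (Σ[ k ∈ ℕ ] (IsProductOfFields T k × v ≡ sign k))
  ⊎ ((¬ (Σ[ k ∈ ℕ ] IsProductOfFields T k)) × v ≡ + 0)

-- Ramanujan sum c(r, R/Ann(x)) = φ(R/Ann x)/φ(R/Ann rx) · μ(R/Ann rx),
-- given the value m = μ(R/Ann(rx)).  (φ ≥ 1 always, so pred is harmless.)
ramanujan : ∀ {c ℓ} (R : CommutativeRing c ℓ) (fin : Finite R)
  (r x : CommutativeRing.Carrier R) (m : ℤ) → ℚᵘ
ramanujan R fin r x m =
  mkℚᵘ (m ℤ.* + φ (R/Ann R fin x))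
       (pred (φ (R/Ann R fin (CommutativeRing._*_ R r x))))

_≡_[mod_]ℚ : ℚᵘ → ℚᵘ → ℤ → Set
p ≡ q [mod N ]ℚ = ∃[ k ] ((p ℚᵘ.- q) ≃ mkℚᵘ (N ℤ.* k) 0)

{-# OPTIONS --safe #-}
-- Write A = φ(R/Ann x) and, for r ∈ 𝔪, T = R/Ann(rx). As R is local, T is the zero ring
-- (rx = 0), the field 𝔽₂ (rx ≠ 0 = 𝔪rx) or a local ring that is not a field, so (μ(T), φ(T)) is
-- (1, 1), (-1, 1) or (0, _) and c(r, R/Ann x) = μ(T)·A. It therefore suffices that 4 ∣ (1 - μ(T))·A,
-- i.e. that A is even when 𝔪x ≠ 0 and divisible by 4 when 𝔪²x ≠ 0.
-- The units of R/Ann x are the classes of the a with π a = 1. Descending along 𝔪-multiples (which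
-- shrinks principal ideals) yields z ∈ 𝔪 with zx ≠ 0 = 𝔪zx; as 2 ∈ 𝔪, a ↦ a + z is a fixed-point-free
-- involution of these classes, so A is even. If 𝔪²x ≠ 0, a second descent yields w ∈ 𝔪 with
-- wx ∉ {0, zx} ⊇ 𝔪wx, and a ↦ a + w acts freely on the pairs {a, a + z}, so 4 ∣ A.
module Submission where

open import Level using (_⊔_; 0ℓ)
open import Data.Nat as ℕ using (ℕ; suc; _≤_; _<_; z≤n; s≤s)
open import Data.Nat.Divisibility using (_∣_; m∣m*n; *-monoʳ-∣)
open import Data.Nat.Induction using (<-wellFounded)
open import Induction.WellFounded using (Acc; acc)
open import Data.Nat.Properties using (≤-antisym; m≤n⇒m≤1+n; *-suc)
import Data.Nat.Properties as ℕP
open import Data.List using (List; []; _∷_; length; filter; deduplicate)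
open import Data.List.Properties using (length-removeAt′)
open import Data.List.Relation.Unary.Any using (Any; here; there; _─_; any?; satisfied)
import Data.List.Relation.Unary.Any as Any
import Data.List.Relation.Unary.Any.Properties as AnyProperties
open import Data.List.Relation.Unary.All using (All; []; _∷_)
import Data.List.Relation.Unary.All as All
import Data.List.Relation.Unary.All.Properties as AllProperties
open import Data.List.Relation.Unary.AllPairs using (AllPairs; []; _∷_)
open import Data.List.Relation.Unary.Unique.DecSetoid.Properties using (deduplicate-!)
import Data.List.Membership.Setoid as Membership
import Data.List.Membership.Setoid.Properties as MembershipProperties
import Data.List.Relation.Unary.Unique.Setoid as UniqueSetoid
open import Data.Product using (∃-syntax; _×_; _,_; proj₁; proj₂)
open import Data.Sum as Sum using (_⊎_; inj₁; inj₂)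
open import Data.Empty using (⊥; ⊥-elim)
open import Relation.Nullary using (¬_; ¬?; yes; no)
import Relation.Nullary.Decidable as Dec
open import Relation.Unary using (Pred; Decidable; _⊆_; _∩_; ∁)
open import Relation.Binary.Bundles using (Setoid; DecSetoid)
open import Algebra.Bundles.Raw using (RawRing)
import Algebra.Properties.Ring as RingProperties
open import Data.Fin using (Fin; zero; suc)
open import Data.Integer as ℤ using (ℤ; +_)
import Data.Integer.Properties as ℤP
open import Data.Integer.Divisibility.Signed using (divides; ∣ᵤ⇒∣; ∣m∣n⇒∣m-n) renaming (_∣_ to _∣ℤ_)
open import Data.Integer.Tactic.RingSolver using (solve-∀)
open import Data.Rational.Unnormalised as ℚᵘ using (mkℚᵘ; _≃_; *≡*)
import Data.Rational.Unnormalised.Properties as ℚP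
open import Relation.Binary.Core using (Rel)
open import Relation.Binary.Definitions using (_Respects_) renaming (Decidable to Decidable₂)
open import Relation.Nullary.Decidable using (_⊎-dec_; _×-dec_)
open import Function using (Congruent; _∘_; case_of_)
open import Relation.Binary.PropositionalEquality as ≡ using (_≡_)
open import Data.Bool as Bool using (Bool; true; false; _xor_; _∧_)
open import Data.Bool.Properties using (xor-same; xor-identityʳ; ∧-zeroʳ)
open import Algebra.Bundles using (CommutativeRing)
open import Function.Bundles using (_⇔_; Equivalence; mk⇔)
open import Defs

xor≡false⇒≡ : ∀ {x y} → x xor y ≡ false → x ≡ y
xor≡false⇒≡ {false} {false} _ = ≡.refl
xor≡false⇒≡ {true}  {true}  _ = ≡.refl

module _ {a p q} {A : Set a} {P : Pred A p} {Q : Pred A q}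
         (P? : Decidable P) (Q? : Decidable Q) (P⊆Q : P ⊆ Q) where

  length-filter-mono : ∀ xs → length (filter P? xs) ≤ length (filter Q? xs)
  length-filter-mono [] = z≤n
  length-filter-mono (x ∷ xs) with P? x | Q? x
  ... | yes _  | yes _  = s≤s (length-filter-mono xs)
  ... | yes px | no ¬qx = ⊥-elim (¬qx (P⊆Q px))
  ... | no _   | yes _  = m≤n⇒m≤1+n (length-filter-mono xs)
  ... | no _   | no _   = length-filter-mono xs

  length-filter-strictMono : ∀ {xs} → Any (Q ∩ ∁ P) xs →
                             length (filter P? xs) < length (filter Q? xs)
  length-filter-strictMono {x ∷ xs} (here (qx , ¬px)) with P? x | Q? x
  ... | yes px | _      = ⊥-elim (¬px px)
  ... | no _   | yes _  = s≤s (length-filter-mono xs)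
  ... | no _   | no ¬qx = ⊥-elim (¬qx qx)
  length-filter-strictMono {x ∷ xs} (there w) with P? x | Q? x
  ... | yes _  | yes _  = s≤s (length-filter-strictMono w)
  ... | yes px | no ¬qx = ⊥-elim (¬qx (P⊆Q px))
  ... | no _   | yes _  = m≤n⇒m≤1+n (length-filter-strictMono w)
  ... | no _   | no _   = length-filter-strictMono w

module _ {a ℓ} (S : Setoid a ℓ) where
  open Setoid S
  open Membership S using (_∈_)
  open UniqueSetoid S using (Unique)

  ∈-─ : ∀ {x y ys} (y∈ys : y ∈ ys) → x ∈ ys → ¬ x ≈ y → x ∈ (ys ─ y∈ys)
  ∈-─ (here y≈z)  (here x≈z)  x≉y = ⊥-elim (x≉y (trans x≈z (sym y≈z)))
  ∈-─ (here _)    (there x∈ys) _  = x∈ys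
  ∈-─ (there _)   (here x≈z)   _  = here x≈z
  ∈-─ (there y∈ys) (there x∈ys) x≉y = there (∈-─ y∈ys x∈ys x≉y)

  unique-length-≤ : ∀ {xs ys} → Unique xs → All (_∈ ys) xs → length xs ≤ length ys
  unique-length-≤ [] [] = z≤n
  unique-length-≤ {x ∷ xs} {ys} (x≉xs ∷ xs!) (x∈ys ∷ xs⊆ys) =
    ≡.subst (suc (length xs) ≤_) (≡.sym (length-removeAt′ ys _))
      (s≤s (unique-length-≤ xs! (All.zipWith (λ (x≉z , z∈ys) → ∈-─ x∈ys z∈ys (x≉z ∘ sym))
                                             (x≉xs , xs⊆ys))))

module Classes {a ℓ p} (S : DecSetoid a ℓ) {U : Pred (DecSetoid.Carrier S) p} (U? : Decidable U) where
  open DecSetoid S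
  open Membership setoid using (_∈_)
  open UniqueSetoid setoid using (Unique)

  record IsTransversal (ts : List Carrier) : Set (a ⊔ ℓ ⊔ p) where
    field
      unique : Unique ts
      all-U  : All U ts
      covers : ∀ {x} → U x → x ∈ ts

  transversal-length : ∀ {ts us} → IsTransversal ts → IsTransversal us → length ts ≡ length us
  transversal-length T U =
    ≤-antisym (unique-length-≤ setoid (unique T) (All.map (covers U) (all-U T)))
              (unique-length-≤ setoid (unique U) (All.map (covers T) (all-U U)))
    where open IsTransversal

  classes : List Carrier → List Carrier
  classes xs = deduplicate _≟_ (filter U? xs)

  classes-isTransversal : U Respects _≈_ → ∀ {xs} → (∀ x → x ∈ xs) → IsTransversal (classes xs)
  classes-isTransversal U-resp {xs} complete = record
    { unique = deduplicate-! S (filter U? xs)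
    ; all-U  = AllProperties.deduplicate⁺ _≟_ (AllProperties.all-filter U? xs)
    ; covers = λ {x} ux → AnyProperties.deduplicate⁺ _≟_ (λ z≈y x≈y → trans x≈y (sym z≈y))
                 (MembershipProperties.∈-filter⁺ setoid U? U-resp (complete x) ux)
    }

module Orbits {a ℓ} (S : DecSetoid a ℓ) (τ : DecSetoid.Carrier S → DecSetoid.Carrier S)
  (τ-cong : Congruent (DecSetoid._≈_ S) (DecSetoid._≈_ S) τ)
  (τ-involutive : ∀ x → DecSetoid._≈_ S (τ (τ x)) x) where
  open DecSetoid S

  infix 4 _≈τ_
  _≈τ_ : Rel Carrier ℓ
  x ≈τ y = x ≈ y ⊎ x ≈ τ y

  τ-injective : ∀ {x y} → τ x ≈ τ y → x ≈ y
  τ-injective {x} {y} τx≈τy = trans (sym (τ-involutive x)) (trans (τ-cong τx≈τy) (τ-involutive y))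

  τ-swap : ∀ {x y} → τ x ≈ y → x ≈ τ y
  τ-swap {x} τx≈y = trans (sym (τ-involutive x)) (τ-cong τx≈y)

  ≈τ-sym : ∀ {x y} → x ≈τ y → y ≈τ x
  ≈τ-sym (inj₁ x≈y)  = inj₁ (sym x≈y)
  ≈τ-sym (inj₂ x≈τy) = inj₂ (τ-swap (sym x≈τy))

  ≈τ-trans : ∀ {x y z} → x ≈τ y → y ≈τ z → x ≈τ z
  ≈τ-trans (inj₁ x≈y)  (inj₁ y≈z)  = inj₁ (trans x≈y y≈z)
  ≈τ-trans (inj₁ x≈y)  (inj₂ y≈τz) = inj₂ (trans x≈y y≈τz)
  ≈τ-trans (inj₂ x≈τy) (inj₁ y≈z)  = inj₂ (trans x≈τy (τ-cong y≈z))
  ≈τ-trans (inj₂ x≈τy) (inj₂ y≈τz) = inj₁ (trans x≈τy (sym (τ-swap (sym y≈τz))))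

  _≈τ?_ : Decidable₂ _≈τ_
  x ≈τ? y = (x ≟ y) ⊎-dec (x ≟ τ y)

  decSetoid : DecSetoid a ℓ
  decSetoid = record
    { Carrier = Carrier
    ; _≈_ = _≈τ_
    ; isDecEquivalence = record
      { isEquivalence = record { refl = inj₁ refl ; sym = ≈τ-sym ; trans = ≈τ-trans }
      ; _≟_ = _≈τ?_
      }
    }

  ≈τ-τˡ : ∀ {x y} → τ x ≈τ y → x ≈τ y
  ≈τ-τˡ (inj₁ τx≈y)  = inj₂ (τ-swap τx≈y)
  ≈τ-τˡ (inj₂ τx≈τy) = inj₁ (τ-injective τx≈τy)

  open Membership setoid using (_∈_)

  withImages : List Carrier → List Carrier
  withImages []       = []
  withImages (t ∷ ts) = t ∷ τ t ∷ withImages ts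

  length-withImages : ∀ ts → length (withImages ts) ≡ 2 ℕ.* length ts
  length-withImages []       = ≡.refl
  length-withImages (t ∷ ts) =
    ≡.trans (≡.cong (2 ℕ.+_) (length-withImages ts)) (≡.sym (*-suc 2 (length ts)))

  ≉-withImages : ∀ {x ts} → All (λ t → ¬ x ≈τ t) ts → All (λ t → ¬ x ≈ t) (withImages ts)
  ≉-withImages []            = []
  ≉-withImages (x≉t ∷ x≉ts) = (x≉t ∘ inj₁) ∷ (x≉t ∘ inj₂) ∷ ≉-withImages x≉ts

  ∈-withImages : ∀ {x ts} → Any (x ≈τ_) ts → x ∈ withImages ts
  ∈-withImages (here (inj₁ x≈t))  = here x≈t
  ∈-withImages (here (inj₂ x≈τt)) = there (here x≈τt)
  ∈-withImages (there x∈ts)       = there (there (∈-withImages x∈ts))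

  module _ {p} {U : Pred Carrier p} (U-resp : U Respects _≈_) (U-τ : ∀ {x} → U x → U (τ x)) where

    U-resp-≈τ : U Respects _≈τ_
    U-resp-≈τ (inj₁ x≈y)  ux = U-resp x≈y ux
    U-resp-≈τ {x} {y} (inj₂ x≈τy) ux = U-resp (τ-involutive y) (U-τ (U-resp x≈τy ux))

    module _ (U? : Decidable U) (τ-fixedPointFree : ∀ x → ¬ τ x ≈ x) where
      private
        module S = Classes S U?
        module O = Classes decSetoid U?

      withImages-isTransversal : ∀ {ts} → O.IsTransversal ts → S.IsTransversal (withImages ts)
      withImages-isTransversal {ts} T = record
        { unique = unique! (O.IsTransversal.unique T)
        ; all-U  = all-U (O.IsTransversal.all-U T)
        ; covers = ∈-withImages ∘ O.IsTransversal.covers T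
        }
        where
        unique! : ∀ {ts} → AllPairs (λ s t → ¬ s ≈τ t) ts → AllPairs (λ s t → ¬ s ≈ t) (withImages ts)
        unique! []             = []
        unique! {t ∷ _} (t≉ts ∷ ts!) =
          ((λ t≈τt → τ-fixedPointFree t (sym t≈τt)) ∷ ≉-withImages t≉ts)
          ∷ ≉-withImages (All.map (_∘ ≈τ-τˡ) t≉ts)
          ∷ unique! ts!
        all-U : ∀ {ts} → All U ts → All U (withImages ts)
        all-U []         = []
        all-U (ut ∷ uts) = ut ∷ U-τ ut ∷ all-U uts

      length-classes≡2*length-orbits : ∀ {xs} → (∀ x → x ∈ xs) →
        length (S.classes xs) ≡ 2 ℕ.* length (O.classes xs)
      length-classes≡2*length-orbits {xs} complete = ≡.trans
        (S.transversal-length (S.classes-isTransversal U-resp complete)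
          (withImages-isTransversal (O.classes-isTransversal U-resp-≈τ (Any.map inj₁ ∘ complete))))
        (length-withImages (O.classes xs))

module ModuloAnnihilator {c ℓ} (R : CommutativeRing c ℓ) where
  open CommutativeRing R
  open import Algebra.Properties.Ring ring
    using ([y-z]x≈yx-zx; x∙y⁻¹≈ε⇒x≈y; x≈y⇒x∙y⁻¹≈ε; +-cancelˡ; -‿distribˡ-*)
  open import Algebra.Properties.CommutativeSemigroup *-commutativeSemigroup using (x∙yz≈y∙xz)
  open import Relation.Binary.Reasoning.Setoid setoid

  unit*y≈0⇒y≈0 : ∀ {u y} → IsUnit R u → u * y ≈ 0# → y ≈ 0#
  unit*y≈0⇒y≈0 {u} {y} (b , ub≈1) uy≈0 = begin
    y             ≈⟨ *-identityˡ y ⟨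
    1# * y        ≈⟨ *-congʳ (trans (sym ub≈1) (*-comm u b)) ⟩
    (b * u) * y   ≈⟨ *-assoc b u y ⟩
    b * (u * y)   ≈⟨ *-congˡ uy≈0 ⟩
    b * 0#        ≈⟨ zeroʳ b ⟩
    0#            ∎

  ay≈by⇒[a-b]y≈0 : ∀ {a b y} → a * y ≈ b * y → (a - b) * y ≈ 0#
  ay≈by⇒[a-b]y≈0 {a} {b} {y} ay≈by = trans ([y-z]x≈yx-zx y a b) (x≈y⇒x∙y⁻¹≈ε ay≈by)

  [a-b]y≈0⇒ay≈by : ∀ {a b y} → (a - b) * y ≈ 0# → a * y ≈ b * y
  [a-b]y≈0⇒ay≈by {a} {b} {y} [a-b]y≈0 =
    x∙y⁻¹≈ε⇒x≈y (a * y) (b * y) (trans (sym ([y-z]x≈yx-zx y a b)) [a-b]y≈0)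

  [a+h]y≈[b+h]y : ∀ {a b y} h → a * y ≈ b * y → (a + h) * y ≈ (b + h) * y
  [a+h]y≈[b+h]y {a} {b} {y} h ay≈by = begin
    (a + h) * y     ≈⟨ distribʳ y a h ⟩
    a * y + h * y   ≈⟨ +-congʳ ay≈by ⟩
    b * y + h * y   ≈⟨ distribʳ y b h ⟨
    (b + h) * y     ∎

  [a+h]y≈[a+g]y⇒hy≈gy : ∀ {a h g y} → (a + h) * y ≈ (a + g) * y → h * y ≈ g * y
  [a+h]y≈[a+g]y⇒hy≈gy {a} {h} {g} {y} e =
    +-cancelˡ (a * y) (h * y) (g * y) (trans (sym (distribʳ y a h)) (trans e (distribʳ y a g)))

  [a+h]y≈ay⇒hy≈0 : ∀ {a h y} → (a + h) * y ≈ a * y → h * y ≈ 0#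
  [a+h]y≈ay⇒hy≈0 {a} {y = y} e =
    trans ([a+h]y≈[a+g]y⇒hy≈gy (trans e (*-congʳ (sym (+-identityʳ a))))) (zeroˡ y)

  [a+h+h]y≈ay+[2h]y : ∀ a h y → ((a + h) + h) * y ≈ a * y + ((1# + 1#) * h) * y
  [a+h+h]y≈ay+[2h]y a h y = begin
    ((a + h) + h) * y           ≈⟨ distribʳ y (a + h) h ⟩
    (a + h) * y + h * y         ≈⟨ +-congʳ (distribʳ y a h) ⟩
    (a * y + h * y) + h * y     ≈⟨ +-assoc _ _ _ ⟩
    a * y + (h * y + h * y)     ≈⟨ +-congˡ (distribʳ y h h) ⟨
    a * y + (h + h) * y         ≈⟨ +-congˡ (*-congʳ (+-cong (*-identityˡ h) (*-identityˡ h))) ⟨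
    a * y + (1# * h + 1# * h) * y ≈⟨ +-congˡ (*-congʳ (distribʳ h 1# 1#)) ⟨
    a * y + ((1# + 1#) * h) * y ∎

  quotientRing : Carrier → CommutativeRing c ℓ
  quotientRing y = record
    { Carrier = Carrier
    ; _≈_ = λ a b → a * y ≈ b * y
    ; _+_ = _+_ ; _*_ = _*_ ; -_ = -_ ; 0# = 0# ; 1# = 1#
    ; isCommutativeRing = record
      { isRing = record
        { +-isAbelianGroup = record
          { isGroup = record
            { isMonoid = record
              { isSemigroup = record
                { isMagma = record
                  { isEquivalence = record { refl = refl ; sym = sym ; trans = trans }
                  ; ∙-cong = +-cong-mod }
                ; assoc = λ a b d → lift (+-assoc a b d) }
              ; identity = (λ a → lift (+-identityˡ a)) , (λ a → lift (+-identityʳ a)) }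
            ; inverse = (λ a → lift (-‿inverseˡ a)) , (λ a → lift (-‿inverseʳ a))
            ; ⁻¹-cong = -‿cong-mod }
          ; comm = λ a b → lift (+-comm a b) }
        ; *-cong = *-cong-mod
        ; *-assoc = λ a b d → lift (*-assoc a b d)
        ; *-identity = (λ a → lift (*-identityˡ a)) , (λ a → lift (*-identityʳ a))
        ; distrib = (λ a b d → lift (distribˡ a b d)) , (λ a b d → lift (distribʳ a b d)) }
      ; *-comm = λ a b → lift (*-comm a b) } }
    where
    lift : ∀ {a b} → a ≈ b → a * y ≈ b * y
    lift = *-congʳ
    +-cong-mod : ∀ {a b d e} → a * y ≈ b * y → d * y ≈ e * y → (a + d) * y ≈ (b + e) * y
    +-cong-mod {a} {b} {d} {e} ay≈by dy≈ey =
      trans (distribʳ y a d) (trans (+-cong ay≈by dy≈ey) (sym (distribʳ y b e)))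
    -‿cong-mod : ∀ {a b} → a * y ≈ b * y → (- a) * y ≈ (- b) * y
    -‿cong-mod {a} {b} ay≈by = trans (sym (-‿distribˡ-* a y)) (trans (-‿cong ay≈by) (-‿distribˡ-* b y))
    *-cong-mod : ∀ {a b d e} → a * y ≈ b * y → d * y ≈ e * y → (a * d) * y ≈ (b * e) * y
    *-cong-mod {a} {b} {d} {e} ay≈by dy≈ey = begin
      (a * d) * y   ≈⟨ *-assoc a d y ⟩
      a * (d * y)   ≈⟨ *-congˡ dy≈ey ⟩
      a * (e * y)   ≈⟨ x∙yz≈y∙xz a e y ⟩
      e * (a * y)   ≈⟨ *-congˡ ay≈by ⟩
      e * (b * y)   ≈⟨ x∙yz≈y∙xz e b y ⟩
      b * (e * y)   ≈⟨ *-assoc b e y ⟨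
      (b * e) * y   ∎

module LocalRing {c ℓ} (R : CommutativeRing c ℓ) (fin : Finite R) (loc : LocalWithResidueF₂ R) where
  open CommutativeRing R hiding (zero)
  open ModuloAnnihilator R
  open Finite fin using (elems; complete) renaming (_≟_ to _≟R_)
  open import Relation.Unary using (_∈_)
  open import Relation.Binary.Reasoning.Setoid setoid

  π : Carrier → Bool
  π = proj₁ loc

  π-cong : ∀ {a b} → a ≈ b → π a ≡ π b
  π-cong = proj₁ (proj₂ loc)

  π-+ : ∀ a b → π (a + b) ≡ π a xor π b
  π-+ = proj₁ (proj₂ (proj₂ loc))

  π-* : ∀ a b → π (a * b) ≡ π a ∧ π b
  π-* = proj₁ (proj₂ (proj₂ (proj₂ loc)))

  π-1 : π 1# ≡ true
  π-1 = proj₁ (proj₂ (proj₂ (proj₂ (proj₂ loc))))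

  π≡false⇔nonunit : ∀ a → (π a ≡ false) ⇔ (¬ IsUnit R a)
  π≡false⇔nonunit = proj₂ (proj₂ (proj₂ (proj₂ (proj₂ loc))))

  𝔪 : Pred Carrier 0ℓ
  𝔪 a = π a ≡ false

  π-0 : π 0# ≡ false
  π-0 = ≡.trans (π-cong (sym (+-identityʳ 0#))) (≡.trans (π-+ 0# 0#) (xor-same (π 0#)))

  π-‿ : ∀ a → π (- a) ≡ π a
  π-‿ a = ≡.sym (xor≡false⇒≡ (≡.trans (≡.sym (π-+ a (- a))) (≡.trans (π-cong (-‿inverseʳ a)) π-0)))

  π-sub : ∀ a b → π (a - b) ≡ π a xor π b
  π-sub a b = ≡.trans (π-+ a (- b)) (≡.cong (π a xor_) (π-‿ b))

  π-+-𝔪 : ∀ {h} a → h ∈ 𝔪 → π (a + h) ≡ π a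
  π-+-𝔪 a h∈𝔪 = ≡.trans (π-+ a _) (≡.trans (≡.cong (π a xor_) h∈𝔪) (xor-identityʳ (π a)))

  𝔪-*ˡ : ∀ {a} b → a ∈ 𝔪 → a * b ∈ 𝔪
  𝔪-*ˡ b a∈𝔪 = ≡.trans (π-* _ b) (≡.cong (_∧ π b) a∈𝔪)

  𝔪-*ʳ : ∀ a {b} → b ∈ 𝔪 → a * b ∈ 𝔪
  𝔪-*ʳ a b∈𝔪 = ≡.trans (π-* a _) (≡.trans (≡.cong (π a ∧_) b∈𝔪) (∧-zeroʳ (π a)))

  2∈𝔪 : 1# + 1# ∈ 𝔪
  2∈𝔪 = ≡.trans (π-+ 1# 1#) (xor-same (π 1#))

  unit? : Decidable (IsUnit R)
  unit? a = Dec.map′ satisfied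
    (λ (b , ab≈1) → Any.map (λ b≈e → trans (*-congˡ (sym b≈e)) ab≈1) (complete b))
    (any? (λ b → (a * b) ≟R 1#) elems)

  π≡true⇒unit : ∀ {a} → π a ≡ true → IsUnit R a
  π≡true⇒unit {a} πa≡true = Dec.decidable-stable (unit? a)
    (λ nonunit → case ≡.trans (≡.sym πa≡true) (Equivalence.from (π≡false⇔nonunit a) nonunit) of λ ())

  𝔪⇒[a-1]-unit : ∀ {a} → a ∈ 𝔪 → IsUnit R (a - 1#)
  𝔪⇒[a-1]-unit {a} a∈𝔪 = π≡true⇒unit (≡.trans (π-sub a 1#) (≡.cong₂ _xor_ a∈𝔪 π-1))

  𝔪⊆-or-counterexample : ∀ {k} {K : Pred Carrier k} → Decidable K → K Respects _≈_ →
                  (∀ {t} → t ∈ 𝔪 → K t) ⊎ ∃[ t ] (t ∈ 𝔪 × ¬ K t)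
  𝔪⊆-or-counterexample {K = K} K? K-resp with any? (λ t → (π t Bool.≟ false) ×-dec ¬? (K? t)) elems
  ... | yes found = inj₂ (satisfied found)
  ... | no none   = inj₁ λ {t} t∈𝔪 → Dec.decidable-stable (K? t) λ ¬Kt →
    none (Any.map (λ t≈e → ≡.trans (π-cong (sym t≈e)) t∈𝔪 , ¬Kt ∘ K-resp (sym t≈e)) (complete t))

  ⟨_⟩ : Carrier → Pred Carrier (c ⊔ ℓ)
  ⟨ v ⟩ a = Any (λ b → a ≈ b * v) elems

  ∈⟨_⟩? : ∀ v → Decidable ⟨ v ⟩
  ∈⟨ v ⟩? a = any? (λ b → a ≟R (b * v)) elems

  ∈⟨⟩ : ∀ {a v} b → a ≈ b * v → a ∈ ⟨ v ⟩
  ∈⟨⟩ b a≈bv = Any.map (λ b≈e → trans a≈bv (*-congʳ b≈e)) (complete b)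

  |⟨_⟩| : Carrier → ℕ
  |⟨ v ⟩| = length (filter ∈⟨ v ⟩? elems)

  -- v = b t v would make (b t - 1) v = 0 with b t - 1 a unit.
  |⟨t*v⟩|<|⟨v⟩| : ∀ {t v} → t ∈ 𝔪 → ¬ v ≈ 0# → |⟨ t * v ⟩| < |⟨ v ⟩|
  |⟨t*v⟩|<|⟨v⟩| {t} {v} t∈𝔪 v≉0 =
    length-filter-strictMono ∈⟨ t * v ⟩? ∈⟨ v ⟩? ⟨tv⟩⊆⟨v⟩
      (Any.map (λ v≈e → ∈⟨⟩ 1# (trans (sym v≈e) (sym (*-identityˡ v))) , v∉⟨tv⟩ ∘ Any.map (trans v≈e))
        (complete v))
    where
    ⟨tv⟩⊆⟨v⟩ : ⟨ t * v ⟩ ⊆ ⟨ v ⟩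
    ⟨tv⟩⊆⟨v⟩ a∈⟨tv⟩ = let (b , a≈b[tv]) = satisfied a∈⟨tv⟩ in
      ∈⟨⟩ (b * t) (trans a≈b[tv] (sym (*-assoc b t v)))
    v∉⟨tv⟩ : ¬ v ∈ ⟨ t * v ⟩
    v∉⟨tv⟩ v∈⟨tv⟩ = let (b , v≈b[tv]) = satisfied v∈⟨tv⟩ in
      v≉0 (unit*y≈0⇒y≈0 (𝔪⇒[a-1]-unit (𝔪-*ʳ b t∈𝔪))
        (ay≈by⇒[a-b]y≈0 (trans (*-assoc b t v) (trans (sym v≈b[tv]) (sym (*-identityˡ v))))))

  record Critical {k} (K : Pred Carrier k) : Set (c ⊔ k) where
    field
      elem      : Carrier
      elem∈𝔪    : elem ∈ 𝔪
      ¬K        : ¬ K elem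
      𝔪*elem⊆K  : ∀ {t} → t ∈ 𝔪 → K (t * elem)

  module _ {k} {K : Pred Carrier k} (K? : Decidable K) (K-resp : K Respects _≈_) (K0 : K 0#) where

    critical-acc : ∀ {v} → Acc _<_ |⟨ v ⟩| → v ∈ 𝔪 → ¬ K v → Critical K
    critical-acc {v} (acc rs) v∈𝔪 ¬Kv with 𝔪⊆-or-counterexample (K? ∘ (_* v)) (K-resp ∘ *-congʳ)
    ... | inj₁ 𝔪v⊆K = record { elem = v ; elem∈𝔪 = v∈𝔪 ; ¬K = ¬Kv ; 𝔪*elem⊆K = 𝔪v⊆K }
    ... | inj₂ (t , t∈𝔪 , ¬Ktv) =
      critical-acc (rs (|⟨t*v⟩|<|⟨v⟩| t∈𝔪 (λ v≈0 → ¬Kv (K-resp (sym v≈0) K0))))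
                   (𝔪-*ʳ t v∈𝔪) ¬Ktv

    critical : ∀ {v} → v ∈ 𝔪 → ¬ K v → Critical K
    critical = critical-acc (<-wellFounded _)

  Ann𝔪 : Pred Carrier (c ⊔ ℓ)
  Ann𝔪 y = ∀ {t} → t ∈ 𝔪 → t * y ≈ 0#

  [ab-1]y≈0⇒y≈0 : ∀ {a b y} → a ∈ 𝔪 → (a * b - 1#) * y ≈ 0# → y ≈ 0#
  [ab-1]y≈0⇒y≈0 {b = b} a∈𝔪 = unit*y≈0⇒y≈0 (𝔪⇒[a-1]-unit (𝔪-*ˡ b a∈𝔪))

  [ab-1]y≈0⇒π≡true : ∀ {a b y} → ¬ y ≈ 0# → (a * b - 1#) * y ≈ 0# → π a ≡ true
  [ab-1]y≈0⇒π≡true {a} y≉0 [ab-1]y≈0 with π a in πa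
  ... | true  = ≡.refl
  ... | false = ⊥-elim (y≉0 ([ab-1]y≈0⇒y≈0 πa [ab-1]y≈0))

  module Annihilator (y : Carrier) where

    decSetoid : DecSetoid c ℓ
    decSetoid = record
      { Carrier = Carrier
      ; _≈_ = FinRawRing._≈_ (R/Ann R fin y)
      ; isDecEquivalence = record
        { isEquivalence = record
          { refl  = ay≈by⇒[a-b]y≈0 refl
          ; sym   = λ e → ay≈by⇒[a-b]y≈0 (sym ([a-b]y≈0⇒ay≈by e))
          ; trans = λ e f → ay≈by⇒[a-b]y≈0 (trans ([a-b]y≈0⇒ay≈by e) ([a-b]y≈0⇒ay≈by f))
          }
        ; _≟_ = FinRawRing._≟_ (R/Ann R fin y)
        }
      }

    Unit : Pred Carrier (c ⊔ ℓ)
    Unit a = Any (λ b → (a * b - 1#) * y ≈ 0#) elems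

    Unit? : Decidable Unit
    Unit? = isUnit? (R/Ann R fin y)

    open Classes decSetoid Unit? public

    Unit-resp : Unit Respects DecSetoid._≈_ decSetoid
    Unit-resp {a} {a′} [a-a′]y≈0 = Any.map λ {b} [ab-1]y≈0 → ay≈by⇒[a-b]y≈0 (begin
      (a′ * b) * y   ≈⟨ *-congʳ (*-comm a′ b) ⟩
      (b * a′) * y   ≈⟨ *-assoc b a′ y ⟩
      b * (a′ * y)   ≈⟨ *-congˡ ([a-b]y≈0⇒ay≈by [a-a′]y≈0) ⟨
      b * (a * y)    ≈⟨ *-assoc b a y ⟨
      (b * a) * y    ≈⟨ *-congʳ (*-comm b a) ⟩
      (a * b) * y    ≈⟨ [a-b]y≈0⇒ay≈by [ab-1]y≈0 ⟩
      1# * y         ∎)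

    elems-complete : ∀ a → Any (DecSetoid._≈_ decSetoid a) elems
    elems-complete a = Any.map (ay≈by⇒[a-b]y≈0 ∘ *-congʳ) (complete a)

    φ≡length : ∀ {ts} → IsTransversal ts → φ (R/Ann R fin y) ≡ length ts
    φ≡length = transversal-length (classes-isTransversal Unit-resp elems-complete)

    π≡true⇒Unit : ∀ {a} → π a ≡ true → Unit a
    π≡true⇒Unit πa≡true = let (b , ab≈1) = π≡true⇒unit πa≡true in
      Any.map (λ b≈e → ay≈by⇒[a-b]y≈0 (*-congʳ (trans (*-congˡ (sym b≈e)) ab≈1))) (complete b)

    Unit⇒π≡true : ¬ y ≈ 0# → ∀ {a} → Unit a → π a ≡ true
    Unit⇒π≡true y≉0 ua = [ab-1]y≈0⇒π≡true y≉0 (proj₂ (satisfied ua))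

    Unit-+-𝔪 : ¬ y ≈ 0# → ∀ {h a} → h ∈ 𝔪 → Unit a → Unit (a + h)
    Unit-+-𝔪 y≉0 {a = a} h∈𝔪 ua = π≡true⇒Unit (≡.trans (π-+-𝔪 a h∈𝔪) (Unit⇒π≡true y≉0 ua))

    Ann𝔪⇒φ≡1 : y ∈ Ann𝔪 → φ (R/Ann R fin y) ≡ 1
    Ann𝔪⇒φ≡1 𝔪y≈0 = φ≡length {1# ∷ []} record
      { unique = [] ∷ []
      ; all-U  = π≡true⇒Unit π-1 ∷ []
      ; covers = λ ua → here (≈1 _ ua)
      }
      where
      ≈1 : ∀ a → Unit a → (a - 1#) * y ≈ 0#
      ≈1 a ua with y ≟R 0#
      ... | yes y≈0 = trans (*-congˡ y≈0) (zeroʳ _)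
      ... | no y≉0  = 𝔪y≈0 (≡.trans (π-sub a 1#) (≡.cong₂ _xor_ (Unit⇒π≡true y≉0 ua) π-1))

  module _ {x : Carrier} where
    open Annihilator x

    private
      infix 4 _≈ₓ_
      _≈ₓ_ : Rel Carrier ℓ
      _≈ₓ_ = DecSetoid._≈_ decSetoid

      +-congʳ-≈ₓ : ∀ h {a b} → a ≈ₓ b → a + h ≈ₓ b + h
      +-congʳ-≈ₓ h = ay≈by⇒[a-b]y≈0 ∘ [a+h]y≈[b+h]y h ∘ [a-b]y≈0⇒ay≈by

      Killed : Pred Carrier ℓ
      Killed v = v * x ≈ 0#

      critical-killed : ∀ {s} → s ∈ 𝔪 → ¬ s * x ≈ 0# → Critical Killed
      critical-killed = critical (λ v → (v * x) ≟R 0#) (λ v≈v′ → trans (*-congʳ (sym v≈v′))) (zeroˡ x)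

    module FirstHalving (z-critical : Critical Killed) where
      open Critical z-critical renaming (elem to z; elem∈𝔪 to z∈𝔪; ¬K to zx≉0; 𝔪*elem⊆K to 𝔪zx≈0)

      x≉0 : ¬ x ≈ 0#
      x≉0 x≈0 = zx≉0 (trans (*-congˡ x≈0) (zeroʳ z))

      a+z+z≈a : ∀ a → (a + z) + z ≈ₓ a
      a+z+z≈a a = ay≈by⇒[a-b]y≈0
        (trans ([a+h+h]y≈ay+[2h]y a z x) (trans (+-congˡ (𝔪zx≈0 2∈𝔪)) (+-identityʳ _)))

      open Orbits decSetoid (_+ z) (+-congʳ-≈ₓ z) a+z+z≈a
        using (_≈τ_; U-resp-≈τ; length-classes≡2*length-orbits) renaming (decSetoid to orbitDecSetoid)

      orbits : List Carrier
      orbits = Classes.classes orbitDecSetoid Unit? elems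

      φ≡2*orbits : φ (R/Ann R fin x) ≡ 2 ℕ.* length orbits
      φ≡2*orbits = length-classes≡2*length-orbits Unit-resp (Unit-+-𝔪 x≉0 z∈𝔪) Unit?
        (λ a a+z≈a → zx≉0 ([a+h]y≈ay⇒hy≈0 ([a-b]y≈0⇒ay≈by a+z≈a))) elems-complete

      KilledOrZ : Pred Carrier ℓ
      KilledOrZ v = v * x ≈ 0# ⊎ v * x ≈ z * x

      critical-killedOrZ : ∀ {r t} → r ∈ 𝔪 → t ∈ 𝔪 → ¬ t * (r * x) ≈ 0# → Critical KilledOrZ
      critical-killedOrZ {r} {t} r∈𝔪 t∈𝔪 trx≉0 = critical
        (λ v → ((v * x) ≟R 0#) ⊎-dec ((v * x) ≟R (z * x)))
        (λ v≈v′ → Sum.map (trans (*-congʳ (sym v≈v′))) (trans (*-congʳ (sym v≈v′))))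
        (inj₁ (zeroˡ x)) r∈𝔪 ¬KilledOrZ
        where
        ¬KilledOrZ : ¬ KilledOrZ r
        ¬KilledOrZ (inj₁ rx≈0)  = trx≉0 (trans (*-congˡ rx≈0) (zeroʳ t))
        ¬KilledOrZ (inj₂ rx≈zx) = trx≉0 (trans (*-congˡ rx≈zx) (trans (sym (*-assoc t z x)) (𝔪zx≈0 t∈𝔪)))

      module SecondHalving (w-critical : Critical KilledOrZ) where
        open Critical w-critical
          renaming (elem to w; elem∈𝔪 to w∈𝔪; ¬K to ¬KilledOrZ-w; 𝔪*elem⊆K to 𝔪w⊆KilledOrZ)

        +w-cong : ∀ {a b} → a ≈τ b → a + w ≈τ b + w
        +w-cong         (inj₁ a≈b)   = inj₁ (+-congʳ-≈ₓ w a≈b)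
        +w-cong {a} {b} (inj₂ a≈b+z) = inj₂ (DecSetoid.trans decSetoid (+-congʳ-≈ₓ w a≈b+z)
          (ay≈by⇒[a-b]y≈0 (*-congʳ (trans (+-assoc b z w) (trans (+-congˡ (+-comm z w)) (sym (+-assoc b w z)))))))

        a+w+w≈a : ∀ a → (a + w) + w ≈τ a
        a+w+w≈a a with 𝔪w⊆KilledOrZ 2∈𝔪
        ... | inj₁ 2wx≈0  = inj₁ (ay≈by⇒[a-b]y≈0
          (trans ([a+h+h]y≈ay+[2h]y a w x) (trans (+-congˡ 2wx≈0) (+-identityʳ _))))
        ... | inj₂ 2wx≈zx = inj₂ (ay≈by⇒[a-b]y≈0
          (trans ([a+h+h]y≈ay+[2h]y a w x) (trans (+-congˡ 2wx≈zx) (sym (distribʳ x a z)))))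

        a+w≉a : ∀ a → ¬ a + w ≈τ a
        a+w≉a a (inj₁ a+w≈a)   = ¬KilledOrZ-w (inj₁ ([a+h]y≈ay⇒hy≈0 ([a-b]y≈0⇒ay≈by a+w≈a)))
        a+w≉a a (inj₂ a+w≈a+z) = ¬KilledOrZ-w (inj₂ ([a+h]y≈[a+g]y⇒hy≈gy ([a-b]y≈0⇒ay≈by a+w≈a+z)))

        open Orbits orbitDecSetoid (_+ w) +w-cong a+w+w≈a
          using () renaming ( decSetoid to orbitDecSetoid₂
                            ; length-classes≡2*length-orbits to length-orbits≡2*length-orbits₂)

        orbits₂ : List Carrier
        orbits₂ = Classes.classes orbitDecSetoid₂ Unit? elems

        φ≡4*orbits₂ : φ (R/Ann R fin x) ≡ 4 ℕ.* length orbits₂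
        φ≡4*orbits₂ = ≡.trans φ≡2*orbits (≡.trans (≡.cong (2 ℕ.*_)
          (length-orbits≡2*length-orbits₂ (U-resp-≈τ Unit-resp (Unit-+-𝔪 x≉0 z∈𝔪)) (Unit-+-𝔪 x≉0 w∈𝔪)
            Unit? a+w≉a (Any.map inj₁ ∘ elems-complete)))
          (≡.sym (ℕP.*-assoc 2 2 (length orbits₂))))

    φ-even : ∀ {s} → s ∈ 𝔪 → ¬ s * x ≈ 0# → 2 ∣ φ (R/Ann R fin x)
    φ-even s∈𝔪 sx≉0 = ≡.subst (2 ∣_) (≡.sym φ≡2*orbits) (m∣m*n (length orbits))
      where open FirstHalving (critical-killed s∈𝔪 sx≉0)

    φ-divisibleBy4 : ∀ {r t} → r ∈ 𝔪 → t ∈ 𝔪 → ¬ t * (r * x) ≈ 0# → 4 ∣ φ (R/Ann R fin x)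
    φ-divisibleBy4 {r} {t} r∈𝔪 t∈𝔪 trx≉0 =
      ≡.subst (4 ∣_) (≡.sym φ≡4*orbits₂) (m∣m*n (length orbits₂))
      where
      rx≉0 : ¬ r * x ≈ 0#
      rx≉0 rx≈0 = trx≉0 (trans (*-congˡ rx≈0) (zeroʳ t))
      open FirstHalving (critical-killed r∈𝔪 rx≉0)
      open SecondHalving (critical-killedOrZ r∈𝔪 t∈𝔪 trx≉0)

  module _ (y : Carrier) where
    private
      T : RawRing c ℓ
      T = FinRawRing.raw (R/Ann R fin y)

    data μ-Case : ℤ → Set (c ⊔ ℓ) where
      zeroRing : y ≈ 0# → μ-Case (+ 1)
      field₂   : ¬ y ≈ 0# → y ∈ Ann𝔪 → μ-Case (sign 1)
      nonField : ∀ {t} → t ∈ 𝔪 → ¬ t * y ≈ 0# → μ-Case (+ 0)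

    module ProductOfFields {k} (F : Fin k → CommutativeRing c ℓ) (F-fields : ∀ i → IsField (F i))
                           (iso : RingIsoToProduct T k F) where
      module F (i : Fin k) = CommutativeRing (F i)
      module F-Properties (i : Fin k) = RingProperties (F.ring i)

      f : Carrier → (i : Fin k) → F.Carrier i
      f = proj₁ iso

      f-≈ : ∀ {a b} → (a - b) * y ≈ 0# ⇔ (∀ i → F._≈_ i (f a i) (f b i))
      f-≈ = proj₁ (proj₂ iso) _ _

      f-surjective : ∀ (v : (i : Fin k) → F.Carrier i) → ∃[ a ] (∀ i → F._≈_ i (f a i) (v i))
      f-surjective = proj₁ (proj₂ (proj₂ iso))

      f-+ : ∀ a b i → F._≈_ i (f (a + b) i) (F._+_ i (f a i) (f b i))
      f-+ = proj₁ (proj₂ (proj₂ (proj₂ iso)))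

      f-* : ∀ a b i → F._≈_ i (f (a * b) i) (F._*_ i (f a i) (f b i))
      f-* = proj₁ (proj₂ (proj₂ (proj₂ (proj₂ iso))))

      f-1 : ∀ i → F._≈_ i (f 1# i) (F.1# i)
      f-1 = proj₂ (proj₂ (proj₂ (proj₂ (proj₂ iso))))

      f-cong : ∀ {a b} → a ≈ b → ∀ i → F._≈_ i (f a i) (f b i)
      f-cong a≈b = Equivalence.to f-≈ (ay≈by⇒[a-b]y≈0 (*-congʳ a≈b))

      f-0 : ∀ i → F._≈_ i (f 0# i) (F.0# i)
      f-0 i = F-Properties.x+x≈x⇒x≈0 i (f 0# i) (F.trans i (F.sym i (f-+ 0# 0# i)) (f-cong (+-identityˡ 0#) i))

      unit⇒f≉0 : ∀ {a} → IsUnit R a → ∀ i → ¬ F._≈_ i (f a i) (F.0# i)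
      unit⇒f≉0 {a} (b , ab≈1) i fa≈0 = proj₁ (F-fields i)
        (F.trans i (F.sym i (f-1 i)) (F.trans i (f-cong (sym ab≈1) i)
          (F.trans i (f-* a b i) (F.trans i (F.*-congʳ i fa≈0) (F.zeroˡ i (f b i))))))

      y≉0 : Fin k → ¬ y ≈ 0#
      y≉0 i y≈0 = proj₁ (F-fields i)
        (F.trans i (F.sym i (f-1 i)) (F.trans i (Equivalence.to f-≈ (trans (*-congˡ y≈0) (zeroʳ _)) i) (f-0 i)))

    noFactors⇒y≈0 : IsProductOfFields T 0 → y ≈ 0#
    noFactors⇒y≈0 (F , F-fields , iso) =
      trans (sym (*-identityˡ y)) (trans ([a-b]y≈0⇒ay≈by (Equivalence.from f-≈ λ ())) (zeroˡ y))
      where open ProductOfFields F F-fields iso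

    oneFactor⇒Ann𝔪 : IsProductOfFields T 1 → y ∈ Ann𝔪
    oneFactor⇒Ann𝔪 (F , F-fields , iso) {t} t∈𝔪 = Dec.decidable-stable ((t * y) ≟R 0#) λ ty≉0 →
      let (b , [tb-1]y≈0) = invertible-mod (ft≉0 ty≉0) in y≉0 zero ([ab-1]y≈0⇒y≈0 t∈𝔪 [tb-1]y≈0)
      where
      open ProductOfFields F F-fields iso
      ft≉0 : ¬ t * y ≈ 0# → ¬ F._≈_ zero (f t zero) (F.0# zero)
      ft≉0 ty≉0 ft≈0 = ty≉0 (trans ([a-b]y≈0⇒ay≈by
        (Equivalence.from f-≈ λ { zero → F.trans zero ft≈0 (F.sym zero (f-0 zero)) })) (zeroˡ y))
      invertible-mod : ¬ F._≈_ zero (f t zero) (F.0# zero) → ∃[ b ] ((t * b - 1#) * y ≈ 0#)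
      invertible-mod ft≉0 =
        let (b′ , ftb′≈1) = proj₂ (F-fields zero) (f t zero) ft≉0
            (b , fb≈b′)   = f-surjective (λ { zero → b′ })
        in b , Equivalence.from f-≈ λ { zero → F.trans zero (f-* t b zero)
                 (F.trans zero (F.*-congˡ zero (fb≈b′ zero)) (F.trans zero ftb′≈1 (F.sym zero (f-1 zero)))) }

    ¬twoFactors : ∀ {k} → ¬ IsProductOfFields T (suc (suc k))
    ¬twoFactors {k} (F , F-fields , iso) = by-π (π e) ≡.refl
      where
      open ProductOfFields F F-fields iso
      [1,0,…] : (i : Fin (suc (suc k))) → F.Carrier i
      [1,0,…] zero    = F.1# zero
      [1,0,…] (suc i) = F.0# (suc i)
      e : Carrier
      e = proj₁ (f-surjective [1,0,…])
      fe≈[1,0,…] : ∀ i → F._≈_ i (f e i) ([1,0,…] i)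
      fe≈[1,0,…] = proj₂ (f-surjective [1,0,…])
      f[1-e]≈0 : F._≈_ zero (f (1# - e) zero) (F.0# zero)
      f[1-e]≈0 = F-Properties.+-identityˡ-unique zero (f (1# - e) zero) (f e zero)
        (F.trans zero (F.sym zero (f-+ (1# - e) e zero))
          (F.trans zero (f-cong (trans (+-assoc 1# (- e) e) (trans (+-congˡ (-‿inverseˡ e)) (+-identityʳ 1#))) zero)
            (F.trans zero (f-1 zero) (F.sym zero (fe≈[1,0,…] zero)))))
      by-π : ∀ b → π e ≡ b → ⊥
      by-π true  πe = unit⇒f≉0 (π≡true⇒unit πe) (suc zero) (fe≈[1,0,…] (suc zero))
      by-π false πe = unit⇒f≉0 (π≡true⇒unit (≡.trans (π-sub 1# e) (≡.cong₂ _xor_ π-1 πe))) zero f[1-e]≈0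

    Ann𝔪⇒productOfFields : y ∈ Ann𝔪 → ∃[ k ] IsProductOfFields T k
    Ann𝔪⇒productOfFields 𝔪y≈0 with y ≟R 0#
    ... | yes y≈0 = 0 , (λ ()) , (λ ()) , (λ _ ()) ,
      (λ _ _ → mk⇔ (λ _ ()) (λ _ → trans (*-congˡ y≈0) (zeroʳ _))) ,
      (λ _ → 0# , λ ()) , (λ _ _ ()) , (λ _ _ ()) , (λ ())
    ... | no y≉0  = 1 , (λ _ → quotientRing y) , (λ _ → 1≉0 , inverse) , (λ a _ → a) ,
      (λ _ _ → mk⇔ (λ [a-b]y≈0 _ → [a-b]y≈0⇒ay≈by [a-b]y≈0)
                   (λ ay≈by → ay≈by⇒[a-b]y≈0 (ay≈by zero))) ,
      (λ v → v zero , λ { zero → refl }) , (λ _ _ _ → refl) , (λ _ _ _ → refl) , (λ _ → refl)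
      where
      1≉0 : ¬ 1# * y ≈ 0# * y
      1≉0 1y≈0y = y≉0 (trans (sym (*-identityˡ y)) (trans 1y≈0y (zeroˡ y)))
      inverse : ∀ a → ¬ a * y ≈ 0# * y → ∃[ b ] ((a * b) * y ≈ 1# * y)
      inverse a ay≉0y with π a in πa
      ... | true  = let (b , ab≈1) = π≡true⇒unit πa in b , *-congʳ ab≈1
      ... | false = ⊥-elim (ay≉0y (trans (𝔪y≈0 πa) (sym (zeroˡ y))))

    μ-case : ∀ {m} → μ-is T m → μ-Case m
    μ-case (inj₁ (0 , P , ≡.refl))                        = zeroRing (noFactors⇒y≈0 P)
    μ-case (inj₁ (1 , P@(F , F-fields , iso) , ≡.refl))   =
      field₂ (ProductOfFields.y≉0 F F-fields iso zero) (oneFactor⇒Ann𝔪 P)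
    μ-case (inj₁ (suc (suc _) , P , _))                   = ⊥-elim (¬twoFactors P)
    μ-case (inj₂ (¬P , ≡.refl))
      with 𝔪⊆-or-counterexample (λ t → (t * y) ≟R 0#) (λ t≈t′ → trans (*-congʳ (sym t≈t′)))
    ... | inj₁ 𝔪y≈0              = ⊥-elim (¬P (Ann𝔪⇒productOfFields 𝔪y≈0))
    ... | inj₂ (t , t∈𝔪 , ty≉0) = nonField t∈𝔪 ty≉0

  module _ {x r : Carrier} where

    ramanujan≃μ*φ : ∀ {m} → μ-Case (r * x) m → ramanujan R fin r x m ≃ mkℚᵘ (m ℤ.* + φ (R/Ann R fin x)) 0
    ramanujan≃μ*φ (zeroRing rx≈0) =
      ℚP.≃-reflexive (≡.cong (mkℚᵘ _ ∘ ℕ.pred)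
        (Annihilator.Ann𝔪⇒φ≡1 (r * x) λ {t} _ → trans (*-congˡ rx≈0) (zeroʳ t)))
    ramanujan≃μ*φ (field₂ _ 𝔪rx≈0) =
      ℚP.≃-reflexive (≡.cong (mkℚᵘ _ ∘ ℕ.pred) (Annihilator.Ann𝔪⇒φ≡1 (r * x) 𝔪rx≈0))
    ramanujan≃μ*φ (nonField _ _) = *≡* ≡.refl

    4∣[1-μ]*φ : r ∈ 𝔪 → ∀ {m} → μ-Case (r * x) m → + 4 ∣ℤ (+ 1 ℤ.- m) ℤ.* + φ (R/Ann R fin x)
    4∣[1-μ]*φ _   (zeroRing _) = divides (+ 0) ≡.refl
    4∣[1-μ]*φ r∈𝔪 (field₂ rx≉0 _) =
      ≡.subst (+ 4 ∣ℤ_) (ℤP.pos-* 2 (φ (R/Ann R fin x))) (∣ᵤ⇒∣ (*-monoʳ-∣ 2 (φ-even r∈𝔪 rx≉0)))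
    4∣[1-μ]*φ r∈𝔪 (nonField t∈𝔪 trx≉0) =
      ≡.subst (+ 4 ∣ℤ_) (≡.sym (ℤP.*-identityˡ _)) (∣ᵤ⇒∣ (φ-divisibleBy4 r∈𝔪 t∈𝔪 trx≉0))

≡[mod]ℚ-fromℤ : ∀ {p q V W N} → p ≃ mkℚᵘ V 0 → q ≃ mkℚᵘ W 0 → N ∣ℤ V ℤ.- W →
                p ≡ q [mod N ]ℚ
≡[mod]ℚ-fromℤ {p} {q} {V} {W} {N} p≃V q≃W (divides k V-W≡k*N) = k , (begin
  p ℚᵘ.- q                    ≈⟨ ℚP.+-cong p≃V (ℚP.-‿cong q≃W) ⟩
  mkℚᵘ V 0 ℚᵘ.- mkℚᵘ W 0     ≈⟨ *≡* (difference V W) ⟩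
  mkℚᵘ (V ℤ.- W) 0            ≡⟨ ≡.cong (λ n → mkℚᵘ n 0) (≡.trans V-W≡k*N (ℤP.*-comm k N)) ⟩
  mkℚᵘ (N ℤ.* k) 0            ∎)
  where
  open ℚP.≃-Reasoning
  difference : ∀ V W → (V ℤ.* + 1 ℤ.+ ℤ.- W ℤ.* + 1) ℤ.* + 1 ≡ (V ℤ.- W) ℤ.* + 1
  difference = solve-∀

[1-m₂]A-[1-m₁]A≡m₁A-m₂A : ∀ m₁ m₂ A →
  (+ 1 ℤ.- m₂) ℤ.* A ℤ.- (+ 1 ℤ.- m₁) ℤ.* A ≡ m₁ ℤ.* A ℤ.- m₂ ℤ.* A
[1-m₂]A-[1-m₁]A≡m₁A-m₂A = solve-∀

open CommutativeRing using (Carrier; _*_)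

lemma4p6 : ∀ {c ℓ} (R : CommutativeRing c ℓ) (fin : Finite R) →
    Frobenius R → LocalWithResidueF₂ R →
    ∀ (r₁ r₂ : Carrier R) → _∈𝔪 R r₁ → _∈𝔪 R r₂ →
    ∀ (x : Carrier R) (m₁ m₂ : ℤ) →
    μ-is (FinRawRing.raw (R/Ann R fin (_*_ R r₁ x))) m₁ →
    μ-is (FinRawRing.raw (R/Ann R fin (_*_ R r₂ x))) m₂ →
    ramanujan R fin r₁ x m₁ ≡ ramanujan R fin r₂ x m₂ [mod + 4 ]ℚ
lemma4p6 R fin _ loc r₁ r₂ r₁∉R× r₂∉R× x m₁ m₂ μ₁ μ₂ =
  ≡[mod]ℚ-fromℤ (ramanujan≃μ*φ case₁) (ramanujan≃μ*φ case₂)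
    (≡.subst (+ 4 ∣ℤ_) ([1-m₂]A-[1-m₁]A≡m₁A-m₂A m₁ m₂ _)
      (∣m∣n⇒∣m-n (4∣[1-μ]*φ (∈𝔪 r₂∉R×) case₂) (4∣[1-μ]*φ (∈𝔪 r₁∉R×) case₁)))
  where
  open LocalRing R fin loc
  ∈𝔪 : ∀ {r} → ¬ IsUnit R r → 𝔪 r
  ∈𝔪 = Equivalence.from (π≡false⇔nonunit _)
  case₁ : μ-Case (_*_ R r₁ x) m₁
  case₁ = μ-case _ μ₁
  case₂ : μ-Case (_*_ R r₂ x) m₂
  case₂ = μ-case _ μ₂
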